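{- Let $F$ be either $\mathbb{Q}$ or $\mathbb{Z}/m\mathbb{Z}$ for a positive integer $m$, let $H$ be an $F$-module, and let $s,k$ be positive integers. Then the number of Freiman $s$-isomorphism classes of subsets of $H$ of cardinality $k$ is at most $k^{2sg(F)k}$.
   Context: $g(F)=1$ if $F$ is a field, and $g(F)$ is the number of distinct prime divisors of $m$ if $F=\mathbb{Z}/m\mathbb{Z}$. A map $\psi$ between subsets of abelian groups is a Freiman $s$-homomorphism if $a_1+\dots+a_s=a_1'+\dots+a_s'$ implies $\psi(a_1)+\dots+\psi(a_s)=\psi(a_1')+\dots+\psi(a_s')$; it is a Freiman $s$-isomorphism if it has an inverse which is also a Freiman $s$-homomorphism. Two sets are in the same class iff there is a Freiman $s$-isomorphism between them. -}

module Defs where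

open import Level using (Level; 0ℓ; _⊔_)
open import Data.Nat as ℕ using (ℕ; zero; suc)
open import Data.Nat.Primality using (Prime; prime?)
open import Data.Nat.Divisibility using (_∣?_)
open import Data.Integer as ℤ using (ℤ; +_; _+_; _*_; -_; _-_)
import Data.Integer.Properties as ℤP
open import Data.Integer.Solver using (module +-*-Solver)
open import Data.Fin using (Fin)
open import Data.Vec using (Vec; []; _∷_; map; foldr)
open import Data.List using (List; filter; length; upTo)
open import Data.Product using (Σ; _,_; proj₁; proj₂; _×_)
open import Relation.Nullary.Decidable using (_×-dec_)
open import Relation.Binary.PropositionalEquality
  using (_≡_; refl; sym; trans; cong; cong₂)
open import Relation.Binary.Structures using (IsEquivalence)
open import Algebra.Bundles using (CommutativeRing)
open import Algebra.Structures using (IsCommutativeRing)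
open import Algebra.Module.Bundles using (Module)
import Data.Rational.Properties as ℚP

ℚ-ring : CommutativeRing 0ℓ 0ℓ
ℚ-ring = ℚP.+-*-commutativeRing

-- The ring ℤ/mℤ : carrier ℤ, equality = congruence modulo m

record _≡[mod_]_ (x : ℤ) (m : ℕ) (y : ℤ) : Set where
  constructor _,_
  field
    quot : ℤ
    quot-eq : x - y ≡ quot * + m

private
  open +-*-Solver

  lem-sym : ∀ x y → y - x ≡ - (x - y)
  lem-sym = solve 2 (λ x y → y :- x := :- (x :- y)) refl

  lem-trans : ∀ x y z → x - z ≡ (x - y) + (y - z)
  lem-trans = solve 3 (λ x y z → x :- z := (x :- y) :+ (y :- z)) refl

  lem-+ : ∀ x y u v → (x + u) - (y + v) ≡ (x - y) + (u - v)
  lem-+ = solve 4 (λ x y u v → (x :+ u) :- (y :+ v) := (x :- y) :+ (u :- v)) refl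

  lem-* : ∀ x y u v → (x * u) - (y * v) ≡ (x - y) * u + y * (u - v)
  lem-* = solve 4 (λ x y u v → (x :* u) :- (y :* v) := (x :- y) :* u :+ y :* (u :- v)) refl

  lem-neg : ∀ x y → (- x) - (- y) ≡ - (x - y)
  lem-neg = solve 2 (λ x y → (:- x) :- (:- y) := :- (x :- y)) refl

  lem-mul1 : ∀ q u m → q * m * u ≡ (q * u) * m
  lem-mul1 = solve 3 (λ q u m → q :* m :* u := (q :* u) :* m) refl

  lem-mul2 : ∀ y r m → y * (r * m) ≡ (y * r) * m
  lem-mul2 = solve 3 (λ y r m → y :* (r :* m) := (y :* r) :* m) refl

  lem-refl : ∀ x → x - x ≡ + 0 * x
  lem-refl = solve 1 (λ x → x :- x := con (+ 0) :* x) refl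

module _ (m : ℕ) where
  private
    _≈_ : ℤ → ℤ → Set
    x ≈ y = x ≡[mod m ] y

    ≡⇒≈ : ∀ {x y} → x ≡ y → x ≈ y
    ≡⇒≈ {x} refl = + 0 , lem-refl x

    ≈-sym : ∀ {x y} → x ≈ y → y ≈ x
    ≈-sym {x} {y} (q , e) = - q ,
      trans (lem-sym x y) (trans (cong -_ e) (ℤP.neg-distribˡ-* q (+ m)))

    ≈-trans : ∀ {x y z} → x ≈ y → y ≈ z → x ≈ z
    ≈-trans {x} {y} {z} (q , e) (r , f) = q + r ,
      trans (lem-trans x y z)
        (trans (cong₂ _+_ e f) (sym (ℤP.*-distribʳ-+ (+ m) q r)))

    +-c : ∀ {x y u v} → x ≈ y → u ≈ v → (x + u) ≈ (y + v)
    +-c {x} {y} {u} {v} (q , e) (r , f) = q + r ,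
      trans (lem-+ x y u v)
        (trans (cong₂ _+_ e f) (sym (ℤP.*-distribʳ-+ (+ m) q r)))

    *-c : ∀ {x y u v} → x ≈ y → u ≈ v → (x * u) ≈ (y * v)
    *-c {x} {y} {u} {v} (q , e) (r , f) = q * u + y * r ,
      trans (lem-* x y u v)
        (trans (cong₂ _+_ (trans (cong (_* u) e) (lem-mul1 q u (+ m)))
                          (trans (cong (y *_) f) (lem-mul2 y r (+ m))))
               (sym (ℤP.*-distribʳ-+ (+ m) (q * u) (y * r))))

    neg-c : ∀ {x y} → x ≈ y → (- x) ≈ (- y)
    neg-c {x} {y} (q , e) = - q ,
      trans (lem-neg x y) (trans (cong -_ e) (ℤP.neg-distribˡ-* q (+ m)))

    module Z = IsCommutativeRing ℤP.+-*-isCommutativeRing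

    isCR : IsCommutativeRing _≈_ _+_ _*_ -_ (+ 0) (+ 1)
    isCR = record
      { isRing = record
        { +-isAbelianGroup = record
          { isGroup = record
            { isMonoid = record
              { isSemigroup = record
                { isMagma = record
                  { isEquivalence = record
                    { refl = ≡⇒≈ refl ; sym = ≈-sym ; trans = ≈-trans }
                  ; ∙-cong = +-c }
                ; assoc = λ x y z → ≡⇒≈ (Z.+-assoc x y z) }
              ; identity = (λ x → ≡⇒≈ (Z.+-identityˡ x))
                         , (λ x → ≡⇒≈ (Z.+-identityʳ x)) }
            ; inverse = (λ x → ≡⇒≈ (Z.-‿inverseˡ x))
                      , (λ x → ≡⇒≈ (Z.-‿inverseʳ x))
            ; ⁻¹-cong = neg-c }
          ; comm = λ x y → ≡⇒≈ (Z.+-comm x y) }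
        ; *-cong = *-c
        ; *-assoc = λ x y z → ≡⇒≈ (Z.*-assoc x y z)
        ; *-identity = (λ x → ≡⇒≈ (Z.*-identityˡ x))
                     , (λ x → ≡⇒≈ (Z.*-identityʳ x))
        ; distrib = (λ x y z → ≡⇒≈ (Z.distribˡ x y z))
                  , (λ x y z → ≡⇒≈ (Z.distribʳ x y z)) }
      ; *-comm = λ x y → ≡⇒≈ (Z.*-comm x y) }

  ℤmod : CommutativeRing 0ℓ 0ℓ
  ℤmod = record { isCommutativeRing = isCR }

ω : ℕ → ℕ
ω m = length (filter (λ p → prime? p ×-dec (p ∣? m)) (upTo (suc m)))

-- A k-subset of H is given by an injective enumeration a : Fin k → H;
-- a map A → B between k-subsets A = im a, B = im b is given by a map of
-- indices f : Fin k → Fin k (x = a i ↦ b (f i)).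

module Freiman {r ℓr c ℓ : Level} {R : CommutativeRing r ℓr} (H : Module R c ℓ) where
  open Module H

  Σᴹ : ∀ {s} → Vec Carrierᴹ s → Carrierᴹ
  Σᴹ = foldr _ _+ᴹ_ 0ᴹ

  Injective : ∀ {k} → (Fin k → Carrierᴹ) → Set ℓ
  Injective a = ∀ i j → a i ≈ᴹ a j → i ≡ j

  record Subset (k : ℕ) : Set (c ⊔ ℓ) where
    field
      elt : Fin k → Carrierᴹ
      inj : Injective elt
  open Subset public

  IsFreimanHom : ∀ {k} (s : ℕ) (A B : Subset k) → (Fin k → Fin k) → Set ℓ
  IsFreimanHom s A B f = ∀ (i j : Vec (Fin _) s) →
    Σᴹ (map (elt A) i) ≈ᴹ Σᴹ (map (elt A) j) →
    Σᴹ (map (λ t → elt B (f t)) i) ≈ᴹ Σᴹ (map (λ t → elt B (f t)) j)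

  FreimanIso : ∀ {k} (s : ℕ) (A B : Subset k) → Set ℓ
  FreimanIso {k} s A B = Σ (Fin k → Fin k) λ f → Σ (Fin k → Fin k) λ g →
    (∀ i → g (f i) ≡ i) × (∀ i → f (g i) ≡ i) ×
    IsFreimanHom s A B f × IsFreimanHom s B A g

data Coeff : Set where
  ℚ′  : Coeff
  Zmod : (m : ℕ) → .(1 ℕ.≤ m) → Coeff

ringOf : Coeff → CommutativeRing 0ℓ 0ℓ
ringOf ℚ′        = ℚ-ring
ringOf (Zmod m _)  = ℤmod m

-- g(F): 1 for the field ℚ, number of distinct prime divisors of m for ℤ/mℤ
-- (for m prime, ℤ/mℤ is a field and ω m = 1, consistently)
g : Coeff → ℕ
g ℚ′       = 1
g (Zmod m _) = ω m

-- "The number of Freiman s-isomorphism classes of k-subsets of H is at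
-- most N": any family of k-subsets that are pairwise not Freiman
-- s-isomorphic (i.e. lie in distinct classes) has at most N members.

AtMostClasses : ∀ {r ℓr c ℓ} {R : CommutativeRing r ℓr} (H : Module R c ℓ)
                (s k N : ℕ) → Set (c ⊔ ℓ)
AtMostClasses H s k N =
  ∀ (t : ℕ) (A : Fin t → Subset k) →
  (∀ i j → FreimanIso s (A i) (A j) → i ≡ j) → t ℕ.≤ N
  where open Freiman H

module Submission where

-- Let a : Fin k → H enumerate a k-subset of a module H over F = ℚ or ℤ/mℤ.  Its
-- relation lattice {v ∈ ℤ^k : Σ vₜ·aₜ = 0} is a subgroup of ℤ^k that is saturated
-- (F = ℚ) or contains m·ℤ^k (F = ℤ/mℤ), and an s-term equation
-- a_{i₁}+…+a_{iₛ} = a_{j₁}+…+a_{jₛ} holds iff its difference vector is a relation.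
-- Among the difference vectors of the equations of a, some K = g(F)·k generate all
-- others under the matching closure (saturated span, resp. span + m·ℤ^k): over ℚ a
-- chain of vectors outside each other's saturated span is linearly independent
-- (Gaussian elimination), so has at most k members; over ℤ/mℤ the same holds modulo
-- each prime p ∣ m, the primes are glued by the Chinese remainder theorem, and a
-- Nakayama-type iteration lifts from the radical of m to m.  Such K equations form
-- a code determining the class (sets with a common code satisfy the same equations,
-- so the identity of indices is a Freiman isomorphism), and there are at most
-- (k^s·k^s)^K = k^(2sgk) codes.  Bases are found using excluded middle, available
-- under double negation because the conclusion, an inequality in ℕ, is decidable.

open import Level using (Level)
open import Function.Base using (id)
open import Function.Definitions using (Injective)
open import Data.Empty using (⊥; ⊥-elim)
open import Data.Product using (Σ; _,_; proj₁; proj₂; _×_)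
open import Data.Sum using (_⊎_; inj₁; inj₂; [_,_]′)
import Data.Sum as Sum
open import Data.Nat as ℕ using (ℕ; zero; suc; z≤n; s≤s; _^_)
import Data.Nat.Properties as ℕP
open import Data.Nat.Divisibility as ℕD using (_∣_; _∣?_; divides; ∣⇒≤)
open import Data.Nat.Primality using (Prime; prime?; prime⇒irreducible; prime⇒nonTrivial)
open import Data.Nat.Primality.Factorisation using (factorise; factorisationHasAllPrimeFactors)
open import Data.Nat.Coprimality using (Coprime; coprime-Bézout)
open import Data.Nat.GCD using (module Bézout)
open import Data.Nat.ListAction using (product)
open import Data.Nat.ListAction.Properties using (∈⇒∣product)
open import Data.Integer as ℤ using (ℤ; +_; -[1+_]; 0ℤ; 1ℤ; -1ℤ; ∣_∣)
import Data.Integer.Properties as ℤP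
import Data.Integer.Solver as ℤSolver
import Data.Nat.Solver as ℕSolver
import Data.Rational as ℚ
import Data.Rational.Properties as ℚP
import Data.Rational.Unnormalised as ℚᵘ
import Data.Rational.Unnormalised.Properties as ℚᵘP
open import Data.Rational.Literals using (fromℤ)
open import Data.Fin using (Fin; zero; suc; combine)
import Data.Fin.Properties as FinP
open import Data.Vec as Vec using (Vec; []; _∷_; toList)
open import Data.List
  using (List; []; _∷_; _++_; map; length; replicate; filter; upTo; allFin; cartesianProduct; cartesianProductWith)
import Data.List.Properties as ListP
open import Data.List.Relation.Unary.Any as Any using (Any; here; there)
import Data.List.Relation.Unary.Any.Properties as AnyP
open import Data.List.Relation.Unary.All as All using (All; []; _∷_)
open import Data.List.Relation.Unary.AllPairs using ([]; _∷_)
open import Data.List.Relation.Unary.Unique.Propositional using (Unique)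
import Data.List.Relation.Unary.Unique.Propositional.Properties as UniqueP
open import Data.List.Membership.Propositional using (_∈_)
open import Data.List.Membership.Propositional.Properties
  using ( ∈-map⁺; ∈-map⁻; ∈-++⁺ˡ; ∈-++⁺ʳ; ∈-++⁻; ∈-filter⁺; ∈-filter⁻; ∈-upTo⁺; ∈-allFin
        ; ∈-cartesianProduct⁺; ∈-cartesianProductWith⁺)
open import Data.List.Relation.Binary.Subset.Propositional using (_⊆_)
open import Data.List.Relation.Binary.Subset.Propositional.Properties using () renaming (map⁺ to ⊆-map)
open import Relation.Nullary using (¬_; Dec; yes; no)
open import Relation.Nullary.Negation using (DoubleNegation)
open import Relation.Nullary.Decidable using (_×-dec_; ¬¬-excluded-middle; decidable-stable; recompute)
open import Relation.Binary.PropositionalEquality as ≡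
  using (_≡_; _≢_; refl; sym; trans; cong; cong₂; subst; module ≡-Reasoning)
open import Algebra.Bundles using (AbelianGroup; CommutativeMonoid; CommutativeRing)
open import Algebra.Module.Bundles using (Module)
import Algebra.Properties.Group as GroupProperties
import Algebra.Properties.CommutativeSemigroup as CommutativeSemigroupProperties
import Relation.Binary.Reasoning.Setoid as SetoidReasoning
open import Defs

private variable
  a ℓ : Level
  A B : Set a
  k p : ℕ

-- Double negation is a monad.  It lets the proof use excluded middle for the
-- undecidable statements "v is a relation of a" on the way to a decidable
-- conclusion (an inequality of natural numbers).
infixl 1 _>>=_

return : A → DoubleNegation A
return x ¬x = ¬x x

_>>=_ : DoubleNegation A → (A → DoubleNegation B) → DoubleNegation B
(m >>= f) ¬y = m (λ x → f x ¬y)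

Filtered : (P : A → Set ℓ) → List A → List A → Set _
Filtered P xs ys = (∀ {y} → y ∈ ys → P y × y ∈ xs) × (∀ {x} → x ∈ xs → P x → x ∈ ys)

¬¬-filter : (P : A → Set ℓ) (xs : List A) → DoubleNegation (Σ (List A) (Filtered P xs))
¬¬-filter P []       = return ([] , (λ ()) , λ ())
¬¬-filter P (x ∷ xs) = ¬¬-excluded-middle >>= λ Px? → ¬¬-filter P xs >>= λ { (ys , sound , complete) →
  return (extend Px? ys (sound , complete)) }
  where
  extend : Dec (P x) → ∀ ys → Filtered P xs ys → Σ (List _) (Filtered P (x ∷ xs))
  extend (yes Px) ys (sound , complete) = x ∷ ys ,
    (λ { (here refl) → Px , here refl ; (there m) → proj₁ (sound m) , there (proj₂ (sound m)) }) ,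
    λ { (here refl) _ → here refl ; (there m) Pz → there (complete m Pz) }
  extend (no ¬Px) ys (sound , complete) = ys ,
    (λ m → proj₁ (sound m) , there (proj₂ (sound m))) ,
    λ { (here refl) Px → ⊥-elim (¬Px Px) ; (there m) Pz → complete m Pz }

¬¬-Fin : ∀ t {Q : Fin t → Set ℓ} → (∀ i → DoubleNegation (Q i)) → DoubleNegation (∀ i → Q i)
¬¬-Fin zero    h = return (λ ())
¬¬-Fin (suc t) {Q} h = h zero >>= λ q₀ → ¬¬-Fin t (λ i → h (suc i)) >>= λ qs →
  return {A = ∀ i → Q i} λ { zero → q₀ ; (suc i) → qs i }

lift-⊆-map : (f : A → B) (ys : List A) (S : List B) → S ⊆ map f ys →
  Σ (List A) λ S′ → map f S′ ≡ S × S′ ⊆ ys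
lift-⊆-map f ys []      S⊆ = [] , refl , λ ()
lift-⊆-map f ys (x ∷ S) S⊆ with ∈-map⁻ f (S⊆ (here refl)) | lift-⊆-map f ys S (λ m → S⊆ (there m))
... | y , y∈ys , refl | S′ , refl , S′⊆ys = y ∷ S′ , refl , λ { (here refl) → y∈ys ; (there m) → S′⊆ys m }

pad : A → (n : ℕ) → List A → Vec A n
pad z zero    xs       = []
pad z (suc n) []       = z ∷ pad z n []
pad z (suc n) (x ∷ xs) = x ∷ pad z n xs

pad-⊇ : (z : A) (n : ℕ) (xs : List A) → length xs ℕ.≤ n → xs ⊆ toList (pad z n xs)
pad-⊇ z (suc n) (y ∷ xs) len (here refl) = here refl
pad-⊇ z (suc n) (y ∷ xs) len (there m)   = there (pad-⊇ z n xs (ℕP.≤-pred len) m)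

pad-⊆ : (z : A) (n : ℕ) (xs : List A) → ∀ {x} → x ∈ toList (pad z n xs) → x ∈ xs ⊎ x ≡ z
pad-⊆ z (suc n) []       (here e)  = inj₂ e
pad-⊆ z (suc n) []       (there m) = pad-⊆ z n [] m
pad-⊆ z (suc n) (y ∷ xs) (here e)  = inj₁ (here e)
pad-⊆ z (suc n) (y ∷ xs) (there m) = Sum.map₁ there (pad-⊆ z n xs m)

allVecs : ∀ k s → List (Vec (Fin k) s)
allVecs k zero    = [] ∷ []
allVecs k (suc s) = cartesianProductWith _∷_ (allFin k) (allVecs k s)

∈-allVecs : ∀ {k s} (v : Vec (Fin k) s) → v ∈ allVecs k s
∈-allVecs []      = here refl
∈-allVecs (x ∷ v) = ∈-cartesianProductWith⁺ _∷_ (∈-allFin x) (∈-allVecs v)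

encodeVec : ∀ {M} (f : A → Fin M) {K} → Vec A K → Fin (M ^ K)
encodeVec f []       = zero
encodeVec f (x ∷ xs) = combine (f x) (encodeVec f xs)

encodeVec-injective : ∀ {M} (f : A → Fin M) → Injective _≡_ _≡_ f → ∀ {K} → Injective _≡_ _≡_ (encodeVec f {K})
encodeVec-injective f f-inj {K = zero}  {[]}     {[]}     _ = refl
encodeVec-injective f f-inj {K = suc K} {x ∷ xs} {y ∷ ys} e
  with FinP.combine-injective (f x) (encodeVec f xs) (f y) (encodeVec f ys) e
... | fx≡fy , rest≡ = cong₂ _∷_ (f-inj fx≡fy) (encodeVec-injective f f-inj rest≡)

-- For a closure relation C (C S x: "x lies in the closure of S"), a C-chain is
-- a list each of whose elements lies outside the closure of the later ones.
data Chain {X : Set} (C : List X → X → Set) : List X → Set where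
  []  : Chain C []
  _∷_ : ∀ {w S} → ¬ C S w → Chain C S → Chain C (w ∷ S)

module _ {X : Set} (C : List X → X → Set)
         (C-weaken : ∀ {S w x} → C S x → C (w ∷ S) x)
         (C-head : ∀ {S w} → C (w ∷ S) w) where

  GreedyExtension : List X → List X → Set
  GreedyExtension G acc = Σ (List X) λ S → Chain C S × (∀ {x} → x ∈ S → x ∈ acc ⊎ x ∈ G) ×
    (∀ {x} → x ∈ G → C S x) × (∀ {x} → C acc x → C S x)

  greedy-extend : ∀ G acc → Chain C acc → DoubleNegation (GreedyExtension G acc)
  greedy-extend [] acc chain = return {A = GreedyExtension [] acc} (acc , chain , (λ m → inj₁ m) , (λ ()) , λ c → c)
  greedy-extend (x ∷ G) acc chain = ¬¬-excluded-middle >>= λ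
    { (yes x∈C) → greedy-extend G acc chain >>= λ { (S , chainS , from , covers , grows) →
        return {A = GreedyExtension (x ∷ G) acc} (S , chainS , (λ m → Sum.map₂ there (from m)) ,
                (λ { (here refl) → grows x∈C ; (there m) → covers m }) , grows) }
    ; (no x∉C) → greedy-extend G (x ∷ acc) (x∉C ∷ chain) >>= λ { (S , chainS , from , covers , grows) →
        return {A = GreedyExtension (x ∷ G) acc} (S , chainS , (λ m → reassoc (from m)) ,
                (λ { (here refl) → grows C-head ; (there m) → covers m }) , λ c → grows (C-weaken c)) } }
    where
    reassoc : ∀ {y} → y ∈ x ∷ acc ⊎ y ∈ G → y ∈ acc ⊎ y ∈ x ∷ G
    reassoc (inj₁ (here e))  = inj₂ (here e)
    reassoc (inj₁ (there m)) = inj₁ m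
    reassoc (inj₂ m)         = inj₂ (there m)

  greedy-chain : ∀ G → DoubleNegation (Σ (List X) λ S → Chain C S × S ⊆ G × (∀ {x} → x ∈ G → C S x))
  greedy-chain G = greedy-extend G [] [] >>= λ { (S , chain , from , covers , _) →
    return (S , chain , (λ {_} m → [ (λ ()) , (λ m′ → m′) ]′ (from m)) , (λ {_} m → covers m)) }

primeDivisor? : ∀ m p → Dec (Prime p × p ∣ m)
primeDivisor? m p = prime? p ×-dec (p ∣? m)

primeDivisors : ℕ → List ℕ
primeDivisors m = filter (primeDivisor? m) (upTo (suc m))

primeDivisors-prime : ∀ m → All Prime (primeDivisors m)
primeDivisors-prime m = All.tabulate λ p∈ → proj₁ (proj₂ (∈-filter⁻ (primeDivisor? m) {xs = upTo (suc m)} p∈))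

primeDivisors-unique : ∀ m → Unique (primeDivisors m)
primeDivisors-unique m = UniqueP.filter⁺ (primeDivisor? m) (UniqueP.upTo⁺ (suc m))

product∣power : ∀ r fs → (∀ {f} → f ∈ fs → f ∣ r) → product fs ∣ r ^ length fs
product∣power r []       divides-r = ℕD.∣-refl
product∣power r (f ∷ fs) divides-r =
  ℕD.*-pres-∣ (divides-r (here refl)) (product∣power r fs (λ f∈fs → divides-r (there f∈fs)))

-- A positive m divides a power of the product of its prime divisors: take the
-- number of prime factors of m (with multiplicity) as exponent.
divides-radical-power : ∀ m → 1 ℕ.≤ m → Σ ℕ λ J → Σ ℕ λ q → product (primeDivisors m) ^ J ≡ q ℕ.* m
divides-radical-power (suc n) _ with factorise (suc n)
... | record { factors = fs ; isFactorisation = m≡Πfs ; factorsPrime = fs-prime }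
  with product∣power (product (primeDivisors (suc n))) fs divides-radical
  where
  divides-radical : ∀ {f} → f ∈ fs → f ∣ product (primeDivisors (suc n))
  divides-radical {f} f∈fs = ∈⇒∣product (∈-filter⁺ (primeDivisor? (suc n))
    (∈-upTo⁺ (s≤s (∣⇒≤ f∣m))) (All.lookup fs-prime f∈fs , f∣m))
    where
    f∣m : f ∣ suc n
    f∣m = ℕD.∣-trans (∈⇒∣product f∈fs) (ℕD.∣-reflexive (sym m≡Πfs))
... | divides q e = length fs , q , trans e (cong (q ℕ.*_) (sym m≡Πfs))

coprime-to-product : ∀ {L} → Prime p → All Prime L → All (p ≢_) L → Coprime p (product L)
coprime-to-product pr L-prime p∉L (d∣p , d∣ΠL) with prime⇒irreducible pr d∣p
... | inj₁ d≡1 = d≡1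
... | inj₂ refl = ⊥-elim (All.lookup p∉L (factorisationHasAllPrimeFactors pr d∣ΠL L-prime) refl)

module IntegerLattices where

  open import Data.Integer using (_+_; _*_; -_; _-_)
  open ℤSolver.+-*-Solver

  -- Integer vectors of length k.  Without function extensionality they are
  -- compared pointwise.
  ℤ^_ : ℕ → Set
  ℤ^ k = Fin k → ℤ

  infix 4 _≋_
  infixl 6 _⊕_
  infixr 7 _⊙_

  _≋_ : ℤ^ k → ℤ^ k → Set
  u ≋ v = ∀ t → u t ≡ v t

  _⊕_ : ℤ^ k → ℤ^ k → ℤ^ k
  (u ⊕ v) t = u t + v t

  _⊙_ : ℤ → ℤ^ k → ℤ^ k
  (c ⊙ v) t = c * v t

  0v : ℤ^ k
  0v _ = 0ℤ

  ≋-sym : {u v : ℤ^ k} → u ≋ v → v ≋ u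
  ≋-sym e t = sym (e t)

  data Span (P : ℤ^ k → Set) : ℤ^ k → Set where
    gen : ∀ {v} → P v → Span P v
    0∈  : Span P 0v
    +∈  : ∀ {u v} → Span P u → Span P v → Span P (u ⊕ v)
    ·∈  : ∀ c {u} → Span P u → Span P (c ⊙ u)
    ≋∈  : ∀ {u v} → u ≋ v → Span P u → Span P v

  record IsSubgroup (W : ℤ^ k → Set ℓ) : Set ℓ where
    field
      ≋-closed : ∀ {u v} → u ≋ v → W u → W v
      0-closed : W 0v
      +-closed : ∀ {u v} → W u → W v → W (u ⊕ v)
      ·-closed : ∀ c {u} → W u → W (c ⊙ u)

  span-least : {W : ℤ^ k → Set ℓ} → IsSubgroup W → {P : ℤ^ k → Set} →
    (∀ {u} → P u → W u) → ∀ {v} → Span P v → W v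
  span-least W h (gen p)   = h p
  span-least W h 0∈        = IsSubgroup.0-closed W
  span-least W h (+∈ a b)  = IsSubgroup.+-closed W (span-least W h a) (span-least W h b)
  span-least W h (·∈ c a)  = IsSubgroup.·-closed W c (span-least W h a)
  span-least W h (≋∈ e a)  = IsSubgroup.≋-closed W e (span-least W h a)

  span-isSubgroup : {P : ℤ^ k → Set} → IsSubgroup (Span P)
  span-isSubgroup = record { ≋-closed = ≋∈ ; 0-closed = 0∈ ; +-closed = +∈ ; ·-closed = ·∈ }

  span-bind : {P Q : ℤ^ k → Set} → (∀ {u} → P u → Span Q u) → ∀ {v} → Span P v → Span Q v
  span-bind = span-least span-isSubgroup

  span-mono : {P Q : ℤ^ k → Set} → (∀ {u} → P u → Q u) → ∀ {v} → Span P v → Span Q v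
  span-mono h = span-bind (λ p → gen (h p))

  span-scale : {P Q : ℤ^ k → Set} (a : ℤ) → (∀ {u} → P u → Span Q (a ⊙ u)) →
    ∀ {v} → Span P v → Span Q (a ⊙ v)
  span-scale a h (gen p)   = h p
  span-scale a h 0∈        = ≋∈ (λ t → sym (ℤP.*-zeroʳ a)) 0∈
  span-scale a h (+∈ x y)  =
    ≋∈ (λ t → sym (ℤP.*-distribˡ-+ a _ _)) (+∈ (span-scale a h x) (span-scale a h y))
  span-scale a h (·∈ c {u} x) =
    ≋∈ (λ t → solve 3 (λ a c x → c :* (a :* x) := a :* (c :* x)) refl a c (u t))
       (·∈ c (span-scale a h x))
  span-scale a h (≋∈ e x)  = ≋∈ (λ t → cong (a *_) (e t)) (span-scale a h x)

  -- The weighted sum Σᵢ cᵢ · h(xᵢ) along a list (surplus entries of either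
  -- list are ignored).  Linear combinations of vectors are its coordinates.
  wsum : {A : Set} → List ℤ → (A → ℤ) → List A → ℤ
  wsum []       h xs       = 0ℤ
  wsum (c ∷ cs) h []       = 0ℤ
  wsum (c ∷ cs) h (x ∷ xs) = c * h x + wsum cs h xs

  lc : List ℤ → List (ℤ^ k) → ℤ^ k
  lc cs S t = wsum cs (λ w → w t) S

  wsum-map : {A B : Set} (cs : List ℤ) (h : B → ℤ) (f : A → B) (xs : List A) →
    wsum cs h (map f xs) ≡ wsum cs (λ x → h (f x)) xs
  wsum-map []       h f xs       = refl
  wsum-map (c ∷ cs) h f []       = refl
  wsum-map (c ∷ cs) h f (x ∷ xs) = cong (λ z → c * h (f x) + z) (wsum-map cs h f xs)

  wsum-vanishing : {A : Set} (cs : List ℤ) (h : A → ℤ) (xs : List A) →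
    (∀ {x} → x ∈ xs → h x ≡ 0ℤ) → wsum cs h xs ≡ 0ℤ
  wsum-vanishing []       h xs       z = refl
  wsum-vanishing (c ∷ cs) h []       z = refl
  wsum-vanishing (c ∷ cs) h (x ∷ xs) z
    rewrite z (here refl) | wsum-vanishing cs h xs (λ m → z (there m)) | ℤP.*-zeroʳ c = refl

  wsum-linear : {A : Set} (a b : ℤ) (g h : A → ℤ) (cs : List ℤ) (xs : List A) →
    wsum cs (λ x → a * g x - h x * b) xs ≡ a * wsum cs g xs - wsum cs h xs * b
  wsum-linear a b g h []       xs = solve 2 (λ a b → con 0ℤ := a :* con 0ℤ :- con 0ℤ :* b) refl a b
  wsum-linear a b g h (c ∷ cs) [] = solve 2 (λ a b → con 0ℤ := a :* con 0ℤ :- con 0ℤ :* b) refl a b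
  wsum-linear a b g h (c ∷ cs) (x ∷ xs) rewrite wsum-linear a b g h cs xs =
    solve 7 (λ a b c gx hx G H → c :* (a :* gx :- hx :* b) :+ (a :* G :- H :* b)
                                := a :* (c :* gx :+ G) :- (c :* hx :+ H) :* b)
      refl a b c (g x) (h x) (wsum cs g xs) (wsum cs h xs)

  wsum-scale : {A : Set} (p : ℤ) (cs : List ℤ) (h : A → ℤ) (xs : List A) →
    wsum (map (p *_) cs) h xs ≡ p * wsum cs h xs
  wsum-scale p []       h xs       = sym (ℤP.*-zeroʳ p)
  wsum-scale p (c ∷ cs) h []       = sym (ℤP.*-zeroʳ p)
  wsum-scale p (c ∷ cs) h (x ∷ xs) rewrite wsum-scale p cs h xs =
    solve 4 (λ p c y W → p :* c :* y :+ p :* W := p :* (c :* y :+ W)) refl p c (h x) (wsum cs h xs)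

  span-lc : {P : ℤ^ k → Set} (cs : List ℤ) (S : List (ℤ^ k)) →
    (∀ {w} → w ∈ S → Span P w) → Span P (lc cs S)
  span-lc []       S       h = ≋∈ (λ t → refl) 0∈
  span-lc (c ∷ cs) []      h = ≋∈ (λ t → refl) 0∈
  span-lc (c ∷ cs) (w ∷ S) h =
    ≋∈ (λ t → refl) (+∈ (·∈ c (h (here refl))) (span-lc cs S (λ m → h (there m))))

  Nontrivial : List ℤ → Set
  Nontrivial = Any (_≢ 0ℤ)

  record Relation (S : List (ℤ^ k)) : Set where
    constructor relation
    field
      coeffs     : List ℤ
      aligned    : length coeffs ≡ length S
      nontrivial : Nontrivial coeffs
      vanishes   : lc coeffs S ≋ 0v

  nontrivial-scale : ∀ p → p ≢ 0ℤ → ∀ cs → Nontrivial cs → Nontrivial (map (p *_) cs)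
  nontrivial-scale p p≢0 cs nz = AnyP.map⁺ (Any.map (λ c≢0 e → [ p≢0 , c≢0 ]′ (ℤP.i*j≡0⇒i≡0∨j≡0 p e)) nz)

  length-middle : {A : Set} (xs : List A) (v : A) (ys : List A) →
    length (xs ++ v ∷ ys) ≡ suc (length (xs ++ ys))
  length-middle xs v ys =
    trans (ListP.length-++ xs) (trans (ℕP.+-suc (length xs) (length ys)) (cong suc (sym (ListP.length-++ xs))))

  move-coeffs : (A : List (ℤ^ k)) (v : ℤ^ k) (B : List (ℤ^ k)) (cs : List ℤ) →
    length cs ≡ length (v ∷ A ++ B) →
    Σ (List ℤ) λ cs′ → length cs′ ≡ length (A ++ v ∷ B) × (Nontrivial cs → Nontrivial cs′) ×
      lc cs′ (A ++ v ∷ B) ≋ lc cs (v ∷ A ++ B)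
  move-coeffs []      v B cs           eq = cs , eq , (λ nz → nz) , λ t → refl
  move-coeffs (a ∷ A) v B (c ∷ d ∷ es) eq with move-coeffs A v B (c ∷ es) (ℕP.suc-injective eq)
  ... | es′ , aligned , nz , same = d ∷ es′ , cong suc aligned ,
    (λ { (here d≢0) → there (nz (here d≢0)) ; (there (here c≢0)) → here c≢0
       ; (there (there nzs)) → there (nz (there nzs)) }) ,
    λ t → trans (cong (λ z → d * a t + z) (same t))
      (solve 4 (λ x y z w → x :+ (y :+ w) := y :+ (x :+ w)) refl (d * a t) (c * v t) (d * a t) (lc es (A ++ B) t))

  move-relation : (A : List (ℤ^ k)) (v : ℤ^ k) (B : List (ℤ^ k)) →
    Relation (v ∷ A ++ B) → Relation (A ++ v ∷ B)
  move-relation A v B (relation cs aligned nz vanishes) with move-coeffs A v B cs aligned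
  ... | cs′ , aligned′ , nz′ , same = relation cs′ aligned′ (nz′ nz) (λ t → trans (same t) (vanishes t))

  tail : ℤ^ suc k → ℤ^ k
  tail w t = w (suc t)

  lift-tails : (S : List (ℤ^ suc k)) → (∀ {w} → w ∈ S → w zero ≡ 0ℤ) →
    Relation (map tail S) → Relation S
  lift-tails S first≡0 (relation ds aligned nz vanishes) =
    relation ds (trans aligned (ListP.length-map tail S)) nz λ
      { zero    → wsum-vanishing ds (λ w → w zero) S first≡0
      ; (suc t) → trans (sym (wsum-map ds (λ w → w t) tail S)) (vanishes t) }

  -- Gaussian elimination against a pivot v (with v₀ ≠ 0) clears the first
  -- coordinate: w ↦ v₀ · tail w − w₀ · tail v.
  eliminate-by : ℤ^ suc k → ℤ^ suc k → ℤ^ k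
  eliminate-by v w t = v zero * w (suc t) - w zero * v (suc t)

  -- A relation (dᵢ) among the eliminated vectors gives the relation
  -- (−Σ dᵢ wᵢ₀ , v₀ d₁ , … , v₀ dₙ) among v ∷ R.
  lift-elimination : (v : ℤ^ suc k) (R : List (ℤ^ suc k)) → v zero ≢ 0ℤ →
    Relation (map (eliminate-by v) R) → Relation (v ∷ R)
  lift-elimination v R v₀≢0 (relation ds aligned nz vanishes) =
    relation ((- D) ∷ map (v₀ *_) ds)
      (cong suc (trans (ListP.length-map _ ds) (trans aligned (ListP.length-map _ R))))
      (there (nontrivial-scale v₀ v₀≢0 ds nz)) vanish
    where
    open ≡-Reasoning
    v₀ = v zero
    D = wsum ds (λ w → w zero) R
    vanish : ∀ t → (- D) * v t + wsum (map (v₀ *_) ds) (λ w → w t) R ≡ 0ℤ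
    vanish zero rewrite wsum-scale v₀ ds (λ w → w zero) R =
      solve 2 (λ D v₀ → (:- D) :* v₀ :+ v₀ :* D := con 0ℤ) refl D v₀
    vanish (suc t) = begin
      (- D) * v (suc t) + wsum (map (v₀ *_) ds) (λ w → w (suc t)) R
        ≡⟨ cong (λ z → (- D) * v (suc t) + z) (wsum-scale v₀ ds (λ w → w (suc t)) R) ⟩
      (- D) * v (suc t) + v₀ * X
        ≡⟨ solve 4 (λ D vt X v₀ → (:- D) :* vt :+ v₀ :* X := v₀ :* X :- D :* vt) refl D (v (suc t)) X v₀ ⟩
      v₀ * X - D * v (suc t)
        ≡⟨ sym (wsum-linear v₀ (v (suc t)) (λ w → w (suc t)) (λ w → w zero) ds R) ⟩
      wsum ds (λ w → eliminate-by v w t) R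
        ≡⟨ sym (wsum-map ds (λ w → w t) (eliminate-by v) R) ⟩
      lc ds (map (eliminate-by v) R) t
        ≡⟨ vanishes t ⟩
      0ℤ ∎
      where X = wsum ds (λ w → w (suc t)) R

  data Pivot (S : List (ℤ^ suc k)) : Set where
    no-pivot : (∀ {w} → w ∈ S → w zero ≡ 0ℤ) → Pivot S
    pivot    : ∀ A v B → S ≡ A ++ v ∷ B → v zero ≢ 0ℤ → Pivot S

  find-pivot : (S : List (ℤ^ suc k)) → Pivot S
  find-pivot [] = no-pivot (λ ())
  find-pivot (w ∷ S) with w zero ℤ.≟ 0ℤ
  ... | no w₀≢0 = pivot [] w S refl w₀≢0
  ... | yes w₀≡0 with find-pivot S
  ...   | no-pivot z        = no-pivot λ { (here refl) → w₀≡0 ; (there m) → z m }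
  ...   | pivot A v B eq nz = pivot (w ∷ A) v B (cong (w ∷_) eq) nz

  dependent : ∀ k (S : List (ℤ^ k)) → k ℕ.< length S → Relation S
  dependent zero (w ∷ S) _ =
    relation (1ℤ ∷ replicate (length S) 0ℤ) (cong suc (ListP.length-replicate (length S))) (here λ ()) λ ()
  dependent (suc k) S k+1<|S| with find-pivot S
  ... | no-pivot first≡0 =
    lift-tails S first≡0 (dependent k (map tail S)
      (subst (k ℕ.<_) (sym (ListP.length-map tail S)) (ℕP.<-trans (ℕP.n<1+n k) k+1<|S|)))
  ... | pivot A v B refl v₀≢0 =
    move-relation A v B (lift-elimination v (A ++ B) v₀≢0 (dependent k (map (eliminate-by v) (A ++ B))
      (subst (k ℕ.<_) (sym (ListP.length-map _ (A ++ B)))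
        (ℕP.≤-pred (subst (suc (suc k) ℕ.≤_) (length-middle A v B) k+1<|S|)))))

  length-bound : (S : List (ℤ^ k)) → ¬ Relation S → length S ℕ.≤ k
  length-bound {k} S independent with length S ℕ.≤? k
  ... | yes |S|≤k = |S|≤k
  ... | no  |S|≰k = ⊥-elim (independent (dependent k S (ℕP.≰⇒> |S|≰k)))

  SmallBasis : (List (ℤ^ k) → ℤ^ k → Set) → ℕ → List (ℤ^ k) → Set
  SmallBasis {k} Cl K G = Σ (List (ℤ^ k)) λ S → length S ℕ.≤ K × S ⊆ G × (∀ {x} → x ∈ G → Cl S x)

  private
    module ℤ+ = GroupProperties (AbelianGroup.group ℤP.+-0-abelianGroup)

  -- v lies in the saturation of the span of S: some nonzero multiple of v is an
  -- integer combination of S.  (After tensoring with ℚ: v lies in the span of S.)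
  SatSpan : List (ℤ^ k) → ℤ^ k → Set
  SatSpan S v = Σ ℤ λ n → n ≢ 0ℤ × Span (_∈ S) (n ⊙ v)

  satSpan-mono : {S S′ : List (ℤ^ k)} → S ⊆ S′ → ∀ {v} → SatSpan S v → SatSpan S′ v
  satSpan-mono S⊆S′ (n , n≢0 , nv∈) = n , n≢0 , span-mono S⊆S′ nv∈

  solve-for-head : ∀ {w : ℤ^ k} {S} c cs → c ≢ 0ℤ → (∀ t → c * w t + lc cs S t ≡ 0ℤ) → SatSpan S w
  solve-for-head {w = w} {S} c cs c≢0 vanishes = c , c≢0 ,
    ≋∈ (λ t → trans (ℤP.-1*i≡-i _) (sym (ℤ+.inverseˡ-unique (c * w t) (lc cs S t) (vanishes t))))
       (·∈ -1ℤ (span-lc cs S gen))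

  -- A SatSpan-chain is linearly independent, hence has at most k members.
  satChain-independent : {S : List (ℤ^ k)} → Chain SatSpan S → ¬ Relation S
  satChain-independent [] (relation [] _ () _)
  satChain-independent {S = w ∷ S} (w∉ ∷ chain) (relation (c ∷ cs) aligned nz vanishes) with c ℤ.≟ 0ℤ
  ... | no c≢0   = w∉ (solve-for-head c cs c≢0 vanishes)
  ... | yes refl with nz
  ...   | here 0≢0 = 0≢0 refl
  ...   | there nz′ = satChain-independent chain (relation cs (ℕP.suc-injective aligned) nz′
          λ t → trans (sym (trans (cong (_+ lc cs S t) (ℤP.*-zeroˡ (w t))) (ℤP.+-identityˡ _))) (vanishes t))

  saturated-basis : (G : List (ℤ^ k)) → DoubleNegation (SmallBasis SatSpan k G)
  saturated-basis G =
    greedy-chain SatSpan (satSpan-mono there) (1ℤ , (λ ()) , ·∈ 1ℤ (gen (here refl))) G >>= λ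
      { (S , chain , S⊆G , covers) →
        return (S , length-bound S (satChain-independent chain) , (λ {_} m → S⊆G m) , (λ {_} m → covers m)) }

  satSpan-sound : {W : ℤ^ k → Set ℓ} → IsSubgroup W → (∀ n {v} → n ≢ 0ℤ → W (n ⊙ v) → W v) →
    ∀ {S} → (∀ {x} → x ∈ S → W x) → ∀ {v} → SatSpan S v → W v
  satSpan-sound W saturated S⊆W (n , n≢0 , nv∈) = saturated n n≢0 (span-least W S⊆W nv∈)

  identity-in-ℤ : ∀ {m n x y} → 1 ℕ.+ y ℕ.* n ≡ x ℕ.* m → 1ℤ + + y * + n ≡ + x * + m
  identity-in-ℤ {m} {n} {x} {y} eq =
    trans (cong (λ z → 1ℤ + z) (sym (ℤP.pos-* y n)))
      (trans (sym (ℤP.pos-+ 1 (y ℕ.* n))) (trans (cong +_ eq) (ℤP.pos-* x m)))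

  bézout : ∀ {a b} → Coprime a b → Σ ℤ λ α → Σ ℤ λ β → α * + a + β * + b ≡ 1ℤ
  bézout {a} {b} coprime with coprime-Bézout coprime
  ... | Bézout.+- x y eq = + x , - + y ,
    trans (cong (λ z → z + - + y * + b) (sym (identity-in-ℤ {a} {b} {x} {y} eq)))
          (solve 2 (λ y b → con 1ℤ :+ y :* b :+ (:- y) :* b := con 1ℤ) refl (+ y) (+ b))
  ... | Bézout.-+ x y eq = - + x , + y ,
    trans (cong (λ z → - + x * + a + z) (sym (identity-in-ℤ {b} {a} {y} {x} eq)))
          (solve 2 (λ x a → (:- x) :* a :+ (con 1ℤ :+ x :* a) := con 1ℤ) refl (+ x) (+ a))

  UnitMod : ℕ → ℤ → Set
  UnitMod p c = Σ ℤ λ u → Σ ℤ λ t → u * c + t * + p ≡ 1ℤ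

  MultipleOf : ℕ → ℤ → Set
  MultipleOf p c = Σ ℤ λ q → c ≡ + p * q

  prime-coprime : ∀ {n} → Prime p → ¬ p ∣ n → Coprime n p
  prime-coprime pr p∤n (d∣n , d∣p) with prime⇒irreducible pr d∣p
  ... | inj₁ d≡1   = d≡1
  ... | inj₂ refl  = ⊥-elim (p∤n d∣n)

  multiple-or-unit : Prime p → (c : ℤ) → MultipleOf p c ⊎ UnitMod p c
  multiple-or-unit {p} pr (+ n) with p ℕD.∣? n
  ... | yes (divides q n≡qp) =
    inj₁ (+ q , trans (cong +_ (trans n≡qp (ℕP.*-comm q p))) (ℤP.pos-* p q))
  ... | no p∤n = inj₂ (bézout (prime-coprime pr p∤n))
  multiple-or-unit {p} pr -[1+ n ] with multiple-or-unit pr (+ suc n)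
  ... | inj₁ (q , e)     = inj₁ (- q , trans (cong -_ e) (ℤP.neg-distribʳ-* (+ p) q))
  ... | inj₂ (u , t , e) = inj₂ (- u , t , trans (cong (_+ t * + p)
          (solve 2 (λ u x → :- u :* :- x := u :* x) refl u (+ suc n))) e)

  divisible-or-primitive : Prime p → (cs : List ℤ) →
    (Σ (List ℤ) λ qs → cs ≡ map (+ p *_) qs) ⊎ Any (UnitMod p) cs
  divisible-or-primitive pr [] = inj₁ ([] , refl)
  divisible-or-primitive pr (c ∷ cs) with multiple-or-unit pr c
  ... | inj₂ unit = inj₂ (here unit)
  ... | inj₁ (q , refl) with divisible-or-primitive pr cs
  ...   | inj₂ unit        = inj₂ (there unit)
  ...   | inj₁ (qs , refl) = inj₁ (q ∷ qs , refl)

  -- The ℓ¹-norm of a coefficient list; it decreases when a relation is divided by p.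
  norm : List ℤ → ℕ
  norm []       = 0
  norm (c ∷ cs) = ∣ c ∣ ℕ.+ norm cs

  norm-nontrivial : ∀ cs → Nontrivial cs → 1 ℕ.≤ norm cs
  norm-nontrivial (c ∷ cs) (here c≢0) =
    ℕP.≤-trans (ℕP.n≢0⇒n>0 (λ e → c≢0 (ℤP.∣i∣≡0⇒i≡0 e))) (ℕP.m≤m+n ∣ c ∣ (norm cs))
  norm-nontrivial (c ∷ cs) (there nz) = ℕP.≤-trans (norm-nontrivial cs nz) (ℕP.m≤n+m (norm cs) ∣ c ∣)

  norm-scale : ∀ p qs → norm (map (+ p *_) qs) ≡ p ℕ.* norm qs
  norm-scale p []       = sym (ℕP.*-zeroʳ p)
  norm-scale p (q ∷ qs) rewrite ℤP.abs-* (+ p) q | norm-scale p qs =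
    sym (ℕP.*-distribˡ-+ p ∣ q ∣ (norm qs))

  record PrimitiveRelation (p : ℕ) (S : List (ℤ^ k)) : Set where
    constructor primitive-relation
    field
      coeffs    : List ℤ
      aligned   : length coeffs ≡ length S
      has-unit  : Any (UnitMod p) coeffs
      vanishes  : lc coeffs S ≋ 0v

  divide-relation : ∀ {S : List (ℤ^ k)} → 1 ℕ.≤ p → ∀ qs → length qs ≡ length S →
    Nontrivial (map (+ p *_) qs) → lc (map (+ p *_) qs) S ≋ 0v → Relation S
  divide-relation {p = p} {S} p≥1 qs aligned nz vanishes =
    relation qs aligned (Any.map (λ pq≢0 q≡0 → pq≢0 (trans (cong (+ p *_) q≡0) (ℤP.*-zeroʳ (+ p)))) (AnyP.map⁻ nz))
      λ t → cancel (ℤP.i*j≡0⇒i≡0∨j≡0 (+ p) (trans (sym (wsum-scale (+ p) qs (λ w → w t) S)) (vanishes t)))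
    where
    cancel : ∀ {x} → + p ≡ 0ℤ ⊎ x ≡ 0ℤ → x ≡ 0ℤ
    cancel (inj₂ x≡0) = x≡0
    cancel (inj₁ p≡0) = ⊥-elim (ℕP.<⇒≢ p≥1 (sym (ℤP.+-injective p≡0)))

  shrink : ∀ {s n} → 1 ℕ.≤ s → 2 ℕ.≤ p → p ℕ.* s ℕ.≤ suc n → s ℕ.≤ n
  shrink {p} {s} {n} s≥1 p≥2 ps≤n+1 = ℕP.≤-pred (begin
    suc s           ≡⟨ ℕP.+-comm 1 s ⟩
    s ℕ.+ 1         ≤⟨ ℕP.+-monoʳ-≤ s (ℕP.≤-trans s≥1 (ℕP.≤-reflexive (sym (ℕP.+-identityʳ s)))) ⟩
    2 ℕ.* s         ≤⟨ ℕP.*-monoˡ-≤ s p≥2 ⟩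
    p ℕ.* s         ≤⟨ ps≤n+1 ⟩
    suc n           ∎)
    where open ℕP.≤-Reasoning

  -- Dividing a relation by p as long as all its coefficients are multiples of p
  -- makes it primitive at p (the norm bounds the number of divisions).
  make-primitive : ∀ {S : List (ℤ^ k)} → Prime p → ∀ n (r : Relation S) →
    norm (Relation.coeffs r) ℕ.≤ n → PrimitiveRelation p S
  make-primitive {p = p} pr n (relation cs aligned nz vanishes) bound with divisible-or-primitive pr cs
  ... | inj₂ unit = primitive-relation cs aligned unit vanishes
  ... | inj₁ (qs , refl) with n
  ...   | zero   = ⊥-elim (ℕP.<⇒≱ (norm-nontrivial _ nz) bound)
  ...   | suc n′ = make-primitive pr n′ divided
      (shrink (norm-nontrivial qs (Relation.nontrivial divided)) p≥2
        (ℕP.≤-trans (ℕP.≤-reflexive (sym (norm-scale p qs))) bound))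
    where
    p≥2 : 2 ℕ.≤ p
    p≥2 = ℕ.nonTrivial⇒n>1 p {{prime⇒nonTrivial pr}}
    divided = divide-relation (ℕP.<⇒≤ p≥2) qs (trans (sym (ListP.length-map _ qs)) aligned) nz vanishes

  to-primitive : ∀ {S : List (ℤ^ k)} → Prime p → Relation S → PrimitiveRelation p S
  to-primitive pr r = make-primitive pr (norm (Relation.coeffs r)) r ℕP.≤-refl

  SpanWith : List (ℤ^ k) → (ℤ^ k → Set) → ℤ^ k → Set
  SpanWith S Q = Span (λ u → u ∈ S ⊎ Q u)

  Multiple : ℕ → ℤ^ k → Set
  Multiple m u = Σ (ℤ^ _) λ w → u ≋ + m ⊙ w

  -- ModSpan m S v: v lies in span S + m·ℤ^k.  (After reduction modulo m: v lies
  -- in the span of S.)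
  ModSpan : ℕ → List (ℤ^ k) → ℤ^ k → Set
  ModSpan m S = SpanWith S (Multiple m)

  modSpan-mono : ∀ {m} {S S′ : List (ℤ^ k)} → S ⊆ S′ → ∀ {v} → ModSpan m S v → ModSpan m S′ v
  modSpan-mono S⊆S′ = span-mono (Sum.map₁ S⊆S′)

  modSpan-sound : ∀ {m} {W : ℤ^ k → Set ℓ} → IsSubgroup W → (∀ w → W (+ m ⊙ w)) →
    ∀ {S} → (∀ {x} → x ∈ S → W x) → ∀ {v} → ModSpan m S v → W v
  modSpan-sound W m-multiples S⊆W = span-least W
    [ S⊆W , (λ { (w , e) → IsSubgroup.≋-closed W (≋-sym e) (m-multiples w) }) ]′

  module ModularBasis (m : ℕ) (G : List (ℤ^ k)) where

    Λ : ℤ^ k → Set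
    Λ = ModSpan m G

    Scaled : ℕ → ℤ^ k → Set
    Scaled r u = Σ (ℤ^ k) λ y → Λ y × u ≋ + r ⊙ y

    Approx : ℕ → List (ℤ^ k) → ℤ^ k → Set
    Approx r S = SpanWith S (Scaled r)

    scaled-≋ : ∀ {r u v} → u ≋ v → Scaled r u → Scaled r v
    scaled-≋ u≋v (y , y∈Λ , e) = y , y∈Λ , λ t → trans (sym (u≋v t)) (e t)

    scaled-· : ∀ c {r u} → Scaled r u → Scaled r (c ⊙ u)
    scaled-· c {r} {u} (y , y∈Λ , e) = c ⊙ y , ·∈ c y∈Λ , λ t →
      trans (cong (c *_) (e t)) (solve 3 (λ c r y → c :* (r :* y) := r :* (c :* y)) refl c (+ r) (y t))

    scaled-mult : ∀ a {r u} → Scaled r u → Scaled (a ℕ.* r) (+ a ⊙ u)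
    scaled-mult a {r} {u} (y , y∈Λ , e) = y , y∈Λ , λ t →
      trans (cong (+ a *_) (e t)) (trans (sym (ℤP.*-assoc (+ a) (+ r) (y t))) (cong (_* y t) (sym (ℤP.pos-* a r))))

    unit-coefficient : ∀ {p S w} c cs → UnitMod p c → Λ w → Scaled p (lc (c ∷ cs) (w ∷ S)) → Approx p S w
    unit-coefficient {p} {S} {w} c cs (u , t₀ , bézout-eq) w∈Λ (y , y∈Λ , e) =
      ≋∈ w≋ (+∈ (gen (inj₂ (u ⊙ y ⊕ t₀ ⊙ w , +∈ (·∈ u y∈Λ) (·∈ t₀ w∈Λ) , λ t → refl)))
                (·∈ (- u) (span-lc cs S (λ s∈S → gen (inj₁ s∈S)))))
      where
      open ≡-Reasoning
      w≋ : ∀ t → + p * (u * y t + t₀ * w t) + (- u) * lc cs S t ≡ w t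
      w≋ t = begin
        + p * (u * y t + t₀ * w t) + (- u) * lc cs S t
          ≡⟨ solve 6 (λ p u y t₀ w X → p :* (u :* y :+ t₀ :* w) :+ (:- u) :* X
                       := u :* (p :* y) :+ t₀ :* p :* w :- u :* X) refl (+ p) u (y t) t₀ (w t) (lc cs S t) ⟩
        u * (+ p * y t) + t₀ * + p * w t - u * lc cs S t
          ≡⟨ cong (λ z → u * z + t₀ * + p * w t - u * lc cs S t) (sym (e t)) ⟩
        u * (c * w t + lc cs S t) + t₀ * + p * w t - u * lc cs S t
          ≡⟨ solve 6 (λ p u c t₀ w X → u :* (c :* w :+ X) :+ t₀ :* p :* w :- u :* X
                       := (u :* c :+ t₀ :* p) :* w) refl (+ p) u c t₀ (w t) (lc cs S t) ⟩
        (u * c + t₀ * + p) * w t ≡⟨ cong (_* w t) bézout-eq ⟩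
        1ℤ * w t                 ≡⟨ ℤP.*-identityˡ (w t) ⟩
        w t ∎

    pChain-unit-free : ∀ {p S} → Prime p → Chain (Approx p) S → (∀ {x} → x ∈ S → Λ x) →
      ∀ cs → length cs ≡ length S → Any (UnitMod p) cs → Scaled p (lc cs S) → ⊥
    pChain-unit-free pr [] S⊆Λ [] aligned () scaled
    pChain-unit-free {p} pr (_∷_ {w} {S} w∉ chain) S⊆Λ (c ∷ cs) aligned unit scaled with multiple-or-unit pr c
    ... | inj₂ c-unit = w∉ (unit-coefficient c cs c-unit (S⊆Λ (here refl)) scaled)
    ... | inj₁ (q , refl) with unit
    ...   | here c-unit = w∉ (unit-coefficient _ cs c-unit (S⊆Λ (here refl)) scaled)
    ...   | there unit′ =
      pChain-unit-free pr chain (λ s∈S → S⊆Λ (there s∈S)) cs (ℕP.suc-injective aligned) unit′ (rest-scaled scaled)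
      where
      -- p q w + Σ cᵢ sᵢ = p y  gives  Σ cᵢ sᵢ = p (y − q w).
      rest-scaled : Scaled p (lc (+ p * q ∷ cs) (w ∷ S)) → Scaled p (lc cs S)
      rest-scaled (y , y∈Λ , e) = y ⊕ (- q) ⊙ w , +∈ y∈Λ (·∈ (- q) (S⊆Λ (here refl))) , λ t → begin
        lc cs S t
          ≡⟨ solve 4 (λ p q w X → X := (p :* q :* w :+ X) :- p :* q :* w) refl (+ p) q (w t) (lc cs S t) ⟩
        (+ p * q * w t + lc cs S t) - + p * q * w t
          ≡⟨ cong (_- + p * q * w t) (e t) ⟩
        + p * y t - + p * q * w t
          ≡⟨ solve 4 (λ p q w y → p :* y :- p :* q :* w := p :* (y :+ (:- q) :* w)) refl (+ p) q (w t) (y t) ⟩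
        + p * (y t + (- q) * w t) ∎
        where open ≡-Reasoning

    pChain-length : ∀ {p S} → Prime p → Chain (Approx p) S → (∀ {x} → x ∈ S → Λ x) → length S ℕ.≤ k
    pChain-length {p} {S} pr chain S⊆Λ = length-bound S independent
      where
      independent : ¬ Relation S
      independent r with to-primitive pr r
      ... | primitive-relation cs aligned unit vanishes = pChain-unit-free pr chain S⊆Λ cs aligned unit
        (0v , 0∈ , λ t → trans (vanishes t) (sym (ℤP.*-zeroʳ (+ p))))

    Approximation : ℕ → ℕ → Set
    Approximation n r = SmallBasis (Approx r) n G

    prime-approximation : ∀ {p} → Prime p → DoubleNegation (Approximation k p)
    prime-approximation {p} pr =
      greedy-chain (Approx p) (span-mono (Sum.map₁ there)) (gen (inj₁ (here refl))) G >>= λ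
        { (S , chain , S⊆G , covers) →
          return (S , pChain-length pr chain (λ s∈S → gen (inj₁ (S⊆G s∈S))) , (λ {_} s∈S → S⊆G s∈S) ,
                  (λ {_} x∈G → covers x∈G)) }

    crt-combine : ∀ {p r S₁ S₂} → Coprime p r → ∀ {x} →
      Approx p S₁ x → Approx r S₂ x → Approx (p ℕ.* r) (S₁ ++ S₂) x
    crt-combine {p} {r} {S₁} {S₂} coprime {x} x₁ x₂ with bézout coprime
    ... | α , β , αp+βr≡1 = ≋∈ split (+∈ (span-scale (β * + r) from₁ x₁) (span-scale (α * + p) from₂ x₂))
      where
      split : ∀ t → (β * + r) * x t + (α * + p) * x t ≡ x t
      split t = trans (solve 5 (λ α p β r x → (β :* r) :* x :+ (α :* p) :* x := (α :* p :+ β :* r) :* x)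
                         refl α (+ p) β (+ r) (x t))
                      (trans (cong (_* x t) αp+βr≡1) (ℤP.*-identityˡ (x t)))
      from₁ : ∀ {u} → u ∈ S₁ ⊎ Scaled p u → Approx (p ℕ.* r) (S₁ ++ S₂) ((β * + r) ⊙ u)
      from₁ (inj₁ u∈S₁) = ·∈ (β * + r) (gen (inj₁ (∈-++⁺ˡ u∈S₁)))
      from₁ {u} (inj₂ u∈pΛ) = gen (inj₂ (scaled-≋ {p ℕ.* r} (λ t → sym (ℤP.*-assoc β (+ r) (u t)))
        (scaled-· β {p ℕ.* r} (subst (λ n → Scaled n (+ r ⊙ u)) (ℕP.*-comm r p) (scaled-mult r {p} u∈pΛ)))))
      from₂ : ∀ {u} → u ∈ S₂ ⊎ Scaled r u → Approx (p ℕ.* r) (S₁ ++ S₂) ((α * + p) ⊙ u)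
      from₂ (inj₁ u∈S₂) = ·∈ (α * + p) (gen (inj₁ (∈-++⁺ʳ S₁ u∈S₂)))
      from₂ {u} (inj₂ u∈rΛ) = gen (inj₂ (scaled-≋ {p ℕ.* r} (λ t → sym (ℤP.*-assoc α (+ p) (u t)))
        (scaled-· α {p ℕ.* r} (scaled-mult p {r} u∈rΛ))))

    radical-approximation : ∀ L → All Prime L → Unique L →
      DoubleNegation (Approximation (length L ℕ.* k) (product L))
    radical-approximation [] [] [] = return {A = Approximation 0 1}
      ([] , z≤n , (λ ()) , λ {x} x∈G → gen (inj₂ (x , gen (inj₁ x∈G) , λ t → sym (ℤP.*-identityˡ (x t)))))
    radical-approximation (p ∷ L) (p-prime ∷ L-prime) (p∉L ∷ L-unique) =
      prime-approximation p-prime >>= λ { (S₁ , |S₁|≤k , S₁⊆G , covers₁) →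
      radical-approximation L L-prime L-unique >>= λ { (S₂ , |S₂|≤ , S₂⊆G , covers₂) →
      return {A = Approximation (length (p ∷ L) ℕ.* k) (product (p ∷ L))}
        (S₁ ++ S₂ ,
         ℕP.≤-trans (ℕP.≤-reflexive (ListP.length-++ S₁)) (ℕP.+-mono-≤ |S₁|≤k |S₂|≤) ,
         (λ {_} s∈S → [ S₁⊆G , S₂⊆G ]′ (∈-++⁻ S₁ s∈S)) ,
         λ {_} x∈G → crt-combine (coprime-to-product p-prime L-prime p∉L) (covers₁ x∈G) (covers₂ x∈G)) } }

    multiple-· : ∀ c {u : ℤ^ k} → Multiple m u → Multiple m (c ⊙ u)
    multiple-· c {u} (w , e) = c ⊙ w , λ t →
      trans (cong (c *_) (e t)) (solve 3 (λ c m w → c :* (m :* w) := m :* (c :* w)) refl c (+ m) (w t))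

    -- Nakayama-type lifting: from G ⊆ span S + r·Λ we get Λ ⊆ span S + r^j·Λ + m·ℤ^k
    -- for every j; once m ∣ r^J this says G ⊆ ModSpan m S.
    module Lifting (S : List (ℤ^ k)) (r : ℕ) (G-approx : ∀ {x} → x ∈ G → Approx r S x) where

      Stage : ℕ → ℤ^ k → Set
      Stage j = SpanWith S (λ u → Scaled (r ^ j) u ⊎ Multiple m u)

      -- Since Λ is generated by G and m·ℤ^k:  Λ ⊆ span S + r·Λ + m·ℤ^k.
      Λ-approx : ∀ {x} → Λ x → SpanWith S (λ u → Scaled r u ⊎ Multiple m u) x
      Λ-approx = span-bind
        [ (λ x∈G → span-mono (Sum.map₂ inj₁) (G-approx x∈G)) , (λ x∈mℤ → gen (inj₂ (inj₂ x∈mℤ))) ]′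

      Λ⊆stage : ∀ j {x} → Λ x → Stage j x
      Λ⊆stage zero    {x} x∈Λ = gen (inj₂ (inj₁ (x , x∈Λ , λ t → sym (ℤP.*-identityˡ (x t)))))
      Λ⊆stage (suc j) x∈Λ = span-bind refine (Λ⊆stage j x∈Λ)
        where
        deepen : ∀ {u} → u ∈ S ⊎ (Scaled r u ⊎ Multiple m u) → Stage (suc j) (+ (r ^ j) ⊙ u)
        deepen (inj₁ u∈S)          = ·∈ (+ (r ^ j)) (gen (inj₁ u∈S))
        deepen {u} (inj₂ (inj₁ u∈rΛ)) =
          gen (inj₂ (inj₁ (subst (λ n → Scaled n (+ (r ^ j) ⊙ u)) (ℕP.*-comm (r ^ j) r) (scaled-mult (r ^ j) {r} u∈rΛ))))
        deepen (inj₂ (inj₂ u∈mℤ))  = gen (inj₂ (inj₂ (multiple-· (+ (r ^ j)) u∈mℤ)))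
        refine : ∀ {u} → u ∈ S ⊎ (Scaled (r ^ j) u ⊎ Multiple m u) → Stage (suc j) u
        refine (inj₁ u∈S)                     = gen (inj₁ u∈S)
        refine (inj₂ (inj₂ u∈mℤ))             = gen (inj₂ (inj₂ u∈mℤ))
        refine (inj₂ (inj₁ (y , y∈Λ , u≋)))   = ≋∈ (≋-sym u≋) (span-scale (+ (r ^ j)) deepen (Λ-approx y∈Λ))

      -- When r^J = q·m, the part r^J·Λ of Stage J lies in m·ℤ^k.
      lift : ∀ J q → r ^ J ≡ q ℕ.* m → ∀ {x} → x ∈ G → ModSpan m S x
      lift J q r^J≡qm x∈G = span-mono absorb (Λ⊆stage J (gen (inj₁ x∈G)))
        where
        absorb : ∀ {u} → u ∈ S ⊎ (Scaled (r ^ J) u ⊎ Multiple m u) → u ∈ S ⊎ Multiple m u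
        absorb (inj₁ u∈S)                = inj₁ u∈S
        absorb (inj₂ (inj₂ u∈mℤ))        = inj₂ u∈mℤ
        absorb (inj₂ (inj₁ (y , _ , e))) = inj₂ (+ q ⊙ y , λ t → trans (e t) (trans
          (cong (λ n → + n * y t) r^J≡qm) (trans (cong (_* y t) (ℤP.pos-* q m))
          (solve 3 (λ q m y → q :* m :* y := m :* (q :* y)) refl (+ q) (+ m) (y t)))))

  modular-basis : ∀ m L → All Prime L → Unique L → ∀ J q → product L ^ J ≡ q ℕ.* m → (G : List (ℤ^ k)) →
    DoubleNegation (SmallBasis (ModSpan m) (length L ℕ.* k) G)
  modular-basis m L L-prime L-unique J q ΠL^J≡qm G =
    radical-approximation L L-prime L-unique >>= λ { (S , |S|≤ , S⊆G , covers) →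
      return (S , |S|≤ , (λ {_} s∈S → S⊆G s∈S) ,
              λ {_} x∈G → Lifting.lift S (product L) covers J q ΠL^J≡qm x∈G) }
    where open ModularBasis m G

open IntegerLattices

record ClosureSystem (k K : ℕ) : Set₁ where
  field
    Cl          : List (ℤ^ k) → ℤ^ k → Set
    Cl-mono     : ∀ {S S′} → S ⊆ S′ → ∀ {v} → Cl S v → Cl S′ v
    small-basis : ∀ G → DoubleNegation (SmallBasis Cl K G)

module Evaluation {r ℓr c ℓ} {R : CommutativeRing r ℓr} (H : Module R c ℓ)
  (ι : ℤ → CommutativeRing.Carrier R)
  (ι-+ : ∀ x y → CommutativeRing._≈_ R (ι (x ℤ.+ y)) (CommutativeRing._+_ R (ι x) (ι y)))
  (ι-* : ∀ x y → CommutativeRing._≈_ R (ι (x ℤ.* y)) (CommutativeRing._*_ R (ι x) (ι y)))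
  (ι-0 : CommutativeRing._≈_ R (ι 0ℤ) (CommutativeRing.0# R))
  (ι-1 : CommutativeRing._≈_ R (ι 1ℤ) (CommutativeRing.1# R))
  where
  open Module H
  open CommutativeRing R using (_+_; reflexive)
  open Freiman H using (Σᴹ)
  open SetoidReasoning ≈ᴹ-setoid
  private
    module +ᴹ = CommutativeSemigroupProperties (CommutativeMonoid.commutativeSemigroup +ᴹ-commutativeMonoid)
    module -ᴹ = GroupProperties +ᴹ-group

  ι-0-action : ∀ y → ι 0ℤ *ₗ y ≈ᴹ 0ᴹ
  ι-0-action y = ≈ᴹ-trans (*ₗ-cong ι-0 ≈ᴹ-refl) (*ₗ-zeroˡ y)

  ι-1-action : ∀ y → ι 1ℤ *ₗ y ≈ᴹ y
  ι-1-action y = ≈ᴹ-trans (*ₗ-cong ι-1 ≈ᴹ-refl) (*ₗ-identityˡ y)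

  eval : ∀ {k} → ℤ^ k → (Fin k → Carrierᴹ) → Carrierᴹ
  eval {zero}  v a = 0ᴹ
  eval {suc k} v a = ι (v zero) *ₗ a zero +ᴹ eval (tail v) (λ t → a (suc t))

  eval-cong : ∀ {k} {v w : ℤ^ k} a → v ≋ w → eval v a ≈ᴹ eval w a
  eval-cong {zero}  a e = ≈ᴹ-refl
  eval-cong {suc k} a e =
    +ᴹ-cong (*ₗ-cong (reflexive (≡.cong ι (e zero))) ≈ᴹ-refl) (eval-cong (λ t → a (suc t)) (λ t → e (suc t)))

  eval-0 : ∀ {k} a → eval {k} 0v a ≈ᴹ 0ᴹ
  eval-0 {zero}  a = ≈ᴹ-refl
  eval-0 {suc k} a = ≈ᴹ-trans (+ᴹ-cong (ι-0-action (a zero)) (eval-0 (λ t → a (suc t)))) (+ᴹ-identityʳ 0ᴹ)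

  eval-⊕ : ∀ {k} (u v : ℤ^ k) a → eval (u ⊕ v) a ≈ᴹ eval u a +ᴹ eval v a
  eval-⊕ {zero}  u v a = ≈ᴹ-sym (+ᴹ-identityˡ 0ᴹ)
  eval-⊕ {suc k} u v a = begin
    ι (u zero ℤ.+ v zero) *ₗ a zero +ᴹ eval (tail u ⊕ tail v) (λ t → a (suc t))
      ≈⟨ +ᴹ-cong (≈ᴹ-trans (*ₗ-cong (ι-+ (u zero) (v zero)) ≈ᴹ-refl) (*ₗ-distribʳ (a zero) (ι (u zero)) (ι (v zero))))
                 (eval-⊕ (tail u) (tail v) (λ t → a (suc t))) ⟩
    (ι (u zero) *ₗ a zero +ᴹ ι (v zero) *ₗ a zero) +ᴹ (eval (tail u) _ +ᴹ eval (tail v) _)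
      ≈⟨ +ᴹ.interchange _ _ _ _ ⟩
    eval u a +ᴹ eval v a ∎

  eval-⊙ : ∀ {k} c (v : ℤ^ k) a → eval (c ⊙ v) a ≈ᴹ ι c *ₗ eval v a
  eval-⊙ {zero}  c v a = ≈ᴹ-sym (*ₗ-zeroʳ (ι c))
  eval-⊙ {suc k} c v a = begin
    ι (c ℤ.* v zero) *ₗ a zero +ᴹ eval (c ⊙ tail v) (λ t → a (suc t))
      ≈⟨ +ᴹ-cong (≈ᴹ-trans (*ₗ-cong (ι-* c (v zero)) ≈ᴹ-refl) (*ₗ-assoc (ι c) (ι (v zero)) (a zero)))
                 (eval-⊙ c (tail v) (λ t → a (suc t))) ⟩
    ι c *ₗ (ι (v zero) *ₗ a zero) +ᴹ ι c *ₗ eval (tail v) (λ t → a (suc t))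
      ≈⟨ ≈ᴹ-sym (*ₗ-distribˡ (ι c) _ _) ⟩
    ι c *ₗ eval v a ∎

  ι-neg : ∀ y → ι -1ℤ *ₗ y ≈ᴹ -ᴹ y
  ι-neg y = -ᴹ.inverseˡ-unique _ _ (begin
    ι -1ℤ *ₗ y +ᴹ y         ≈⟨ +ᴹ-cong ≈ᴹ-refl (≈ᴹ-sym (ι-1-action y)) ⟩
    ι -1ℤ *ₗ y +ᴹ ι 1ℤ *ₗ y ≈⟨ ≈ᴹ-sym (*ₗ-distribʳ y (ι -1ℤ) (ι 1ℤ)) ⟩
    (ι -1ℤ + ι 1ℤ) *ₗ y     ≈⟨ *ₗ-cong (CommutativeRing.sym R (ι-+ -1ℤ 1ℤ)) ≈ᴹ-refl ⟩
    ι 0ℤ *ₗ y               ≈⟨ ι-0-action y ⟩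
    0ᴹ ∎)

  Relations : ∀ {k} → (Fin k → Carrierᴹ) → ℤ^ k → Set ℓ
  Relations a v = eval v a ≈ᴹ 0ᴹ

  relations-subgroup : ∀ {k} (a : Fin k → Carrierᴹ) → IsSubgroup (Relations a)
  relations-subgroup a = record
    { ≋-closed = λ u≋v rel → ≈ᴹ-trans (eval-cong a (≋-sym u≋v)) rel
    ; 0-closed = eval-0 a
    ; +-closed = λ {u} {v} relu relv → ≈ᴹ-trans (eval-⊕ u v a) (≈ᴹ-trans (+ᴹ-cong relu relv) (+ᴹ-identityˡ 0ᴹ))
    ; ·-closed = λ c {u} relu →
        ≈ᴹ-trans (eval-⊙ c u a) (≈ᴹ-trans (*ₗ-cong (CommutativeRing.refl R) relu) (*ₗ-zeroʳ (ι c)))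
    }

  unit : ∀ {k} → Fin k → ℤ^ k
  unit zero    zero    = 1ℤ
  unit zero    (suc t) = 0ℤ
  unit (suc x) zero    = 0ℤ
  unit (suc x) (suc t) = unit x t

  eval-unit : ∀ {k} (x : Fin k) a → eval (unit x) a ≈ᴹ a x
  eval-unit {suc k} zero a =
    ≈ᴹ-trans (+ᴹ-cong (ι-1-action (a zero)) (eval-0 (λ t → a (suc t)))) (+ᴹ-identityʳ (a zero))
  eval-unit {suc k} (suc x) a =
    ≈ᴹ-trans (+ᴹ-cong (ι-0-action (a zero)) (eval-unit x (λ t → a (suc t)))) (+ᴹ-identityˡ (a (suc x)))

  count : ∀ {k s} → Vec (Fin k) s → ℤ^ k
  count []      = 0v
  count (x ∷ i) = unit x ⊕ count i

  sum-count : ∀ {k s} (a : Fin k → Carrierᴹ) (i : Vec (Fin k) s) → Σᴹ (Vec.map a i) ≈ᴹ eval (count i) a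
  sum-count a []      = ≈ᴹ-sym (eval-0 a)
  sum-count a (x ∷ i) =
    ≈ᴹ-trans (+ᴹ-cong (≈ᴹ-sym (eval-unit x a)) (sum-count a i)) (≈ᴹ-sym (eval-⊕ (unit x) (count i) a))

  difference : ∀ {k s} → Vec (Fin k) s × Vec (Fin k) s → ℤ^ k
  difference (i , j) = count i ⊕ -1ℤ ⊙ count j

  eval-difference : ∀ {k s} (a : Fin k → Carrierᴹ) (i j : Vec (Fin k) s) →
    eval (difference (i , j)) a ≈ᴹ Σᴹ (Vec.map a i) +ᴹ -ᴹ Σᴹ (Vec.map a j)
  eval-difference a i j = begin
    eval (count i ⊕ -1ℤ ⊙ count j) a            ≈⟨ eval-⊕ (count i) _ a ⟩
    eval (count i) a +ᴹ eval (-1ℤ ⊙ count j) a  ≈⟨ +ᴹ-cong (≈ᴹ-sym (sum-count a i)) (eval-⊙ -1ℤ (count j) a) ⟩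
    Σᴹ (Vec.map a i) +ᴹ ι -1ℤ *ₗ eval (count j) a
      ≈⟨ +ᴹ-cong ≈ᴹ-refl (≈ᴹ-trans (ι-neg _) (-ᴹ‿cong (≈ᴹ-sym (sum-count a j)))) ⟩
    Σᴹ (Vec.map a i) +ᴹ -ᴹ Σᴹ (Vec.map a j) ∎

  equation⇒relation : ∀ {k s} (a : Fin k → Carrierᴹ) (i j : Vec (Fin k) s) →
    Σᴹ (Vec.map a i) ≈ᴹ Σᴹ (Vec.map a j) → Relations a (difference (i , j))
  equation⇒relation a i j eq = ≈ᴹ-trans (eval-difference a i j) (-ᴹ.x≈y⇒x∙y⁻¹≈ε eq)

  relation⇒equation : ∀ {k s} (a : Fin k → Carrierᴹ) (i j : Vec (Fin k) s) →
    Relations a (difference (i , j)) → Σᴹ (Vec.map a i) ≈ᴹ Σᴹ (Vec.map a j)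
  relation⇒equation a i j rel = -ᴹ.x∙y⁻¹≈ε⇒x≈y _ _ (≈ᴹ-trans (≈ᴹ-sym (eval-difference a i j)) rel)

  difference-diagonal : ∀ {k s} (i : Vec (Fin k) s) → difference (i , i) ≋ 0v
  difference-diagonal i t = solve 1 (λ x → x :+ con -1ℤ :* x := con 0ℤ) ≡.refl (count i t)
    where open ℤSolver.+-*-Solver

  -- Counting Freiman s-isomorphism classes of k-subsets with the help of a
  -- closure system, sound for relation lattices, whose small bases have K elements.
  -- (An index z : Fin k supplies the trivial equation used for padding codes.)
  module Counting {k K} (s : ℕ) (z : Fin k) (C : ClosureSystem k K)
    (Cl-sound : ∀ a {S} → (∀ {x} → x ∈ S → Relations a x) → ∀ {v} → ClosureSystem.Cl C S v → Relations a v)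
    where
    open ClosureSystem C
    open Freiman H using (Subset; elt; FreimanIso)

    Pair : Set
    Pair = Vec (Fin k) s × Vec (Fin k) s

    δ : Pair → ℤ^ k
    δ = difference

    allPairs : List Pair
    allPairs = cartesianProduct (allVecs k s) (allVecs k s)

    ∈-allPairs : ∀ q → q ∈ allPairs
    ∈-allPairs (i , j) = ∈-cartesianProduct⁺ (∈-allVecs i) (∈-allVecs j)

    IsCode : (Fin k → Carrierᴹ) → Vec Pair K → Set ℓ
    IsCode a code = (∀ {q} → q ∈ toList code → Relations a (δ q)) ×
      (∀ q → Relations a (δ q) → Cl (map δ (toList code)) (δ q))

    code-from-basis : ∀ a ys → (∀ {q} → q ∈ ys → Relations a (δ q)) → (∀ q → Relations a (δ q) → q ∈ ys) →
      ∀ S → length S ℕ.≤ K → S ⊆ map δ ys → (∀ {x} → x ∈ map δ ys → Cl S x) → Σ (Vec Pair K) (IsCode a)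
    code-from-basis a ys ys-hold ys-all S |S|≤K S⊆ covers with lift-⊆-map δ ys S S⊆
    ... | S′ , S′↦S , S′⊆ys = code , holds , generates
      where
      trivial : Pair
      trivial = Vec.replicate s z , Vec.replicate s z
      code = pad trivial K S′
      |S′|≤K : length S′ ℕ.≤ K
      |S′|≤K = ≡.subst (ℕ._≤ K) (≡.trans (≡.cong length (≡.sym S′↦S)) (ListP.length-map δ S′)) |S|≤K
      holds : ∀ {q} → q ∈ toList code → Relations a (δ q)
      holds q∈ with pad-⊆ trivial K S′ q∈
      ... | inj₁ q∈S′  = ys-hold (S′⊆ys q∈S′)
      ... | inj₂ ≡.refl = IsSubgroup.≋-closed (relations-subgroup a) (≋-sym (difference-diagonal (Vec.replicate s z)))
                            (IsSubgroup.0-closed (relations-subgroup a))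
      generates : ∀ q → Relations a (δ q) → Cl (map δ (toList code)) (δ q)
      generates q rel = Cl-mono (⊆-map δ (pad-⊇ trivial K S′ |S′|≤K))
        (≡.subst (λ T → Cl T (δ q)) (≡.sym S′↦S) (covers (∈-map⁺ δ (ys-all q rel))))

    code-exists : ∀ a → DoubleNegation (Σ (Vec Pair K) (IsCode a))
    code-exists a =
      ¬¬-filter (λ q → Relations a (δ q)) allPairs >>= λ { (ys , ys-sound , ys-complete) →
      small-basis (map δ ys) >>= λ { (S , |S|≤K , S⊆ , covers) →
      return (code-from-basis a ys (λ q∈ys → proj₁ (ys-sound q∈ys)) (λ q rel → ys-complete (∈-allPairs q) rel)
                S |S|≤K S⊆ covers) } }

    transfer : ∀ a b code → IsCode a code → IsCode b code → ∀ i j →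
      Σᴹ (Vec.map a i) ≈ᴹ Σᴹ (Vec.map a j) → Σᴹ (Vec.map b i) ≈ᴹ Σᴹ (Vec.map b j)
    transfer a b code (_ , a-generated) (b-holds , _) i j eq =
      relation⇒equation b i j (Cl-sound b code-relations (a-generated (i , j) (equation⇒relation a i j eq)))
      where
      code-relations : ∀ {x} → x ∈ map δ (toList code) → Relations b x
      code-relations x∈ with ∈-map⁻ δ x∈
      ... | q , q∈code , ≡.refl = b-holds q∈code

    shared-code⇒isomorphic : ∀ (A B : Subset k) code → IsCode (elt A) code → IsCode (elt B) code →
      FreimanIso s A B
    shared-code⇒isomorphic A B code A-code B-code = id , id , (λ _ → refl) , (λ _ → refl) ,
      transfer (elt A) (elt B) code A-code B-code , transfer (elt B) (elt A) code B-code A-code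

    encodePair : Pair → Fin (k ^ s ℕ.* k ^ s)
    encodePair (i , j) = combine (encodeVec id i) (encodeVec id j)

    encodePair-injective : ∀ {p q} → encodePair p ≡ encodePair q → p ≡ q
    encodePair-injective {i , j} {i′ , j′} e with FinP.combine-injective _ _ _ _ e
    ... | i≡ , j≡ = cong₂ _,_ (indices-injective i≡) (indices-injective j≡)
      where indices-injective = encodeVec-injective id (λ e → e)

    -- Pairwise non-isomorphic k-subsets have pairwise distinct codes.
    at-most-classes : AtMostClasses H s k ((k ^ s ℕ.* k ^ s) ^ K)
    at-most-classes t A distinct = decidable-stable (t ℕ.≤? _)
      (¬¬-Fin t (λ i → code-exists (elt (A i))) >>= λ codes → return (FinP.injective⇒≤ (λ {i} {j} e →
        distinct i j (same-code codes i j (encodeVec-injective encodePair encodePair-injective e)))))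
      where
      same-code : (codes : ∀ i → Σ (Vec Pair K) (IsCode (elt (A i)))) → ∀ i j → proj₁ (codes i) ≡ proj₁ (codes j) →
        FreimanIso s (A i) (A j)
      same-code codes i j e = shared-code⇒isomorphic (A i) (A j) (proj₁ (codes i)) (proj₂ (codes i))
        (≡.subst (IsCode (elt (A j))) (≡.sym e) (proj₂ (codes j)))

saturated-closure : ∀ k → ClosureSystem k k
saturated-closure k = record { Cl = SatSpan ; Cl-mono = satSpan-mono ; small-basis = saturated-basis }

modular-closure : ∀ m → 1 ℕ.≤ m → ∀ k → ClosureSystem k (ω m ℕ.* k)
modular-closure m m≥1 k with divides-radical-power m m≥1
... | J , q , Π^J≡qm = record
  { Cl = ModSpan m
  ; Cl-mono = modSpan-mono {m = m}
  ; small-basis = modular-basis m (primeDivisors m) (primeDivisors-prime m) (primeDivisors-unique m) J q Π^J≡qm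
  }

module RationalCase {c ℓ} (H : Module ℚ-ring c ℓ) where
  open Module H

  fromℤ-+ : ∀ x y → fromℤ (x ℤ.+ y) ≡ fromℤ x ℚ.+ fromℤ y
  fromℤ-+ x y = ℚP.toℚᵘ-injective (ℚᵘP.≃-trans
    (ℚᵘ.*≡* (solve 2 (λ x y → (x :+ y) :* con 1ℤ := (x :* con 1ℤ :+ y :* con 1ℤ) :* con 1ℤ) ≡.refl x y))
    (ℚᵘP.≃-sym (ℚP.toℚᵘ-homo-+ (fromℤ x) (fromℤ y))))
    where open ℤSolver.+-*-Solver

  fromℤ-* : ∀ x y → fromℤ (x ℤ.* y) ≡ fromℤ x ℚ.* fromℤ y
  fromℤ-* x y = ℚP.toℚᵘ-injective (ℚᵘP.≃-trans
    (ℚᵘ.*≡* (solve 2 (λ x y → (x :* y) :* con 1ℤ := (x :* y) :* con 1ℤ) ≡.refl x y))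
    (ℚᵘP.≃-sym (ℚP.toℚᵘ-homo-* (fromℤ x) (fromℤ y))))
    where open ℤSolver.+-*-Solver

  open Evaluation H fromℤ fromℤ-+ fromℤ-* ≡.refl ≡.refl

  relations-saturated : ∀ {k} (a : Fin k → Carrierᴹ) n {v : ℤ^ k} → n ≢ 0ℤ → Relations a (n ⊙ v) → Relations a v
  relations-saturated a n {v} n≢0 rel = begin
    eval v a                            ≈⟨ ≈ᴹ-sym (*ₗ-identityˡ _) ⟩
    ℚ.1ℚ *ₗ eval v a                    ≈⟨ *ₗ-cong (≡.sym (ℚP.*-inverseˡ (fromℤ n) {{n≠0}})) ≈ᴹ-refl ⟩
    (n⁻¹ ℚ.* fromℤ n) *ₗ eval v a       ≈⟨ *ₗ-assoc _ _ _ ⟩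
    n⁻¹ *ₗ (fromℤ n *ₗ eval v a)        ≈⟨ *ₗ-cong ≡.refl (≈ᴹ-trans (≈ᴹ-sym (eval-⊙ n v a)) rel) ⟩
    n⁻¹ *ₗ 0ᴹ                           ≈⟨ *ₗ-zeroʳ _ ⟩
    0ᴹ ∎
    where
    open SetoidReasoning ≈ᴹ-setoid
    n≠0 : ℚ.NonZero (fromℤ n)
    n≠0 = ℕ.≢-nonZero (λ e → n≢0 (ℤP.∣i∣≡0⇒i≡0 e))
    n⁻¹ = ℚ.1/_ (fromℤ n) {{n≠0}}

  classes : ∀ s k → Fin k → AtMostClasses H s k ((k ^ s ℕ.* k ^ s) ^ k)
  classes s k z = Counting.at-most-classes s z (saturated-closure k)
    (λ a → satSpan-sound (relations-subgroup a) (relations-saturated a))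

module ModularCase (m : ℕ) (m≥1 : 1 ℕ.≤ m) {c ℓ} (H : Module (ℤmod m) c ℓ) where
  open Module H
  private module ℤ/m = CommutativeRing (ℤmod m)

  open Evaluation H id (λ x y → ℤ/m.refl) (λ x y → ℤ/m.refl) ℤ/m.refl ℤ/m.refl

  m≈0 : + m ℤ/m.≈ 0ℤ
  m≈0 = record { quot = 1ℤ ; quot-eq = solve 1 (λ x → x :- con 0ℤ := con 1ℤ :* x) ≡.refl (+ m) }
    where open ℤSolver.+-*-Solver

  relations-contain-m : ∀ {k} (a : Fin k → Carrierᴹ) (w : ℤ^ k) → Relations a (+ m ⊙ w)
  relations-contain-m a w = ≈ᴹ-trans (eval-⊙ (+ m) w a) (≈ᴹ-trans (*ₗ-cong m≈0 ≈ᴹ-refl) (*ₗ-zeroˡ _))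

  classes : ∀ s k → Fin k → AtMostClasses H s k ((k ^ s ℕ.* k ^ s) ^ (ω m ℕ.* k))
  classes s k z = Counting.at-most-classes s z (modular-closure m m≥1 k)
    (λ a → modSpan-sound {m = m} (relations-subgroup a) (relations-contain-m a))

bound-shape : ∀ k s γ K → K ≡ γ ℕ.* k → (k ^ s ℕ.* k ^ s) ^ K ≡ k ^ (2 ℕ.* s ℕ.* γ ℕ.* k)
bound-shape k s γ K refl = trans (cong (_^ (γ ℕ.* k)) (sym (ℕP.^-distribˡ-+-* k s s)))
  (trans (ℕP.^-*-assoc k (s ℕ.+ s) (γ ℕ.* k))
    (cong (k ^_) (solve 3 (λ s γ k → (s :+ s) :* (γ :* k) := con 2 :* s :* γ :* k) refl s γ k)))
  where open ℕSolver.+-*-Solver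

open import Data.Nat using (ℕ; _≤_; _*_; _^_)

lemma5 : (F : Coeff) {c ℓ : _} (H : Module (ringOf F) c ℓ) (s k : ℕ) →
    1 ≤ s → 1 ≤ k →
    AtMostClasses H s k (k ^ (2 * s * g F * k))
lemma5 ℚ′ H s (suc k) _ _ =
  subst (AtMostClasses H s (suc k)) (bound-shape (suc k) s 1 (suc k) (sym (ℕP.*-identityˡ (suc k))))
    (RationalCase.classes H s (suc k) zero)
lemma5 (Zmod m m≥1) H s (suc k) _ _ =
  subst (AtMostClasses H s (suc k)) (bound-shape (suc k) s (ω m) (ω m * suc k) refl)
    (ModularCase.classes m (recompute (1 ℕ.≤? m) m≥1) H s (suc k) zero)
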